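{- Let $y_1\neq y_2\in\mathbf{Z}$ and $Q\in\mathbf{Z}\setminus\{0\}$ be such that $Q\mid y_1-y_2$ and $Q$ is not divisible by any prime in $S$. Then \[ \prod_{v\in S} \min(|y_1|_v,|y_2|_v)\le \frac{2}{Q} \cdot \prod_{v\in S} |y_1y_2|_v . \]
   Context: $S$ is a finite set consisting of finitely many (finite) prime numbers together with the symbol $\infty$. For a prime $v\in S$, $|\cdot|_v$ is the standard $v$-adic absolute value on $\mathbf{Q}$ (for $x\in\mathbf{Z}$, $|x|_v=v^{ -m}$ where $m$ is the largest integer with $v^m\mid x$, extended multiplicatively), and $|\cdot|_\infty$ is the usual Archimedean absolute value. -}

module Defs where

open import Data.Nat as ℕ using (ℕ; zero; suc)
open import Data.Nat.Divisibility using (_∣?_)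
open import Data.Integer as ℤ using (ℤ; +_)
open import Data.Rational using (ℚ; 0ℚ; 1ℚ; _/_; _*_; _⊓_)
open import Data.List using (List; []; _∷_)
open import Relation.Nullary using (yes; no)

-- ppow p n f : the largest power of p dividing n (computed with fuel f;
-- with f = n, p ≥ 2 and n > 0 this is exactly the p-part of n).
ppow : ℕ → ℕ → ℕ → ℕ
ppow zero    n f       = 1
ppow (suc p) n zero    = 1
ppow (suc p) n (suc f) with suc p ∣? n
... | yes _ = suc p ℕ.* ppow (suc p) (n ℕ./ suc p) f
... | no  _ = 1

-- v-adic absolute value |x|_v = v^(-m), m = v-adic valuation; |0|_v = 0.
absP : ℕ → ℤ → ℚ
absP v x with ℤ.∣ x ∣
... | zero  = 0ℚ
... | suc n with ppow v (suc n) (suc n)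
...   | zero  = 0ℚ
...   | suc k = (+ 1) / suc k

absInf : ℤ → ℚ
absInf x = (+ ℤ.∣ x ∣) / 1

prodP : List ℕ → (ℕ → ℚ) → ℚ
prodP []       f = 1ℚ
prodP (v ∷ vs) f = f v * prodP vs f

-- ∏_{v ∈ S} min(|y1|_v, |y2|_v), where S = (finite primes) ∪ {∞}
prodMin : List ℕ → ℤ → ℤ → ℚ
prodMin S y₁ y₂ = (absInf y₁ ⊓ absInf y₂) * prodP S (λ v → absP v y₁ ⊓ absP v y₂)

prodAbs : List ℕ → ℤ → ℚ
prodAbs S y = absInf y * prodP S (λ v → absP v y)

module Submission where

-- Write a = ∣y₁∣, b = ∣y₂∣, and for a prime v let part v n = v ^ ord_v(n) be the v-part of n ≠ 0,
-- so that ∣n∣_v = 1 / part v n.  Put G = ∏_{v ∈ S} min(part v a, part v b) and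
-- L = ∏_{v ∈ S} max(part v a, part v b) (the S-parts of gcd(a, b) and lcm(a, b)).  Then the left side
-- is min(a, b) / L, and since part v (ab) = part v a · part v b = min · max, the right side is
-- (2 / Q) · ab / (G L).  As ab = min(a, b) · max(a, b), the claim becomes Q G ≤ 2 max(a, b).  Now G is
-- a product of powers of distinct primes of S, each dividing a and b and hence y₁ - y₂, and Q is prime
-- to S, so Q G divides y₁ - y₂ ≠ 0; and ∣y₁ - y₂∣ ≤ a + b ≤ 2 max(a, b).  If y₁ y₂ = 0 both sides are 0.

module Arithmetic where

  open import Data.Nat.Base
  open import Data.Nat.Properties
  open import Data.Nat.Divisibility
  open import Algebra.Properties.CommutativeSemigroup *-commutativeSemigroup
    using (x∙yz≈y∙xz) renaming (interchange to *-interchange)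
  open import Data.List using (List; []; _∷_)
  open import Data.List.Relation.Unary.All using (All; []; _∷_)
  open import Data.Sum using (inj₁; inj₂)
  open import Relation.Binary.PropositionalEquality

  private variable i j : ℕ

  ^-monoʳ-∣ : ∀ p → i ≤ j → p ^ i ∣ p ^ j
  ^-monoʳ-∣ {i} {j} p i≤j = divides (p ^ (j ∸ i)) (begin
    p ^ j               ≡⟨ cong (p ^_) (m+[n∸m]≡n i≤j) ⟨
    p ^ (i + (j ∸ i))   ≡⟨ ^-distribˡ-+-* p i (j ∸ i) ⟩
    p ^ i * p ^ (j ∸ i) ≡⟨ *-comm (p ^ i) _ ⟩
    p ^ (j ∸ i) * p ^ i ∎)
    where open ≡-Reasoning

  ⊓*⊔≡* : ∀ m n → m ⊓ n * (m ⊔ n) ≡ m * n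
  ⊓*⊔≡* m n with ≤-total m n
  ... | inj₁ m≤n = cong₂ _*_ (m≤n⇒m⊓n≡m m≤n) (m≤n⇒m⊔n≡n m≤n)
  ... | inj₂ n≤m = trans (cong₂ _*_ (m≥n⇒m⊓n≡n n≤m) (m≥n⇒m⊔n≡m n≤m)) (*-comm n m)

  ⊓-nonZero : ∀ m n .{{_ : NonZero m}} .{{_ : NonZero n}} → NonZero (m ⊓ n)
  ⊓-nonZero m n = >-nonZero (⊓-glb (>-nonZero⁻¹ m) (>-nonZero⁻¹ n))

  ⊔-nonZero : ∀ m n .{{_ : NonZero m}} → NonZero (m ⊔ n)
  ⊔-nonZero m n = >-nonZero (<-≤-trans (>-nonZero⁻¹ m) (m≤m⊔n m n))

  ⊓*[q*[lo*hi]]≤2*[m*n]*hi : ∀ m n q lo hi → q * lo ≤ 2 * (m ⊔ n) →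
                             m ⊓ n * (q * (lo * hi)) ≤ 2 * (m * n) * hi
  ⊓*[q*[lo*hi]]≤2*[m*n]*hi m n q lo hi q*lo≤2*[m⊔n] = begin
    m ⊓ n * (q * (lo * hi))      ≡⟨ cong (m ⊓ n *_) (*-assoc q lo hi) ⟨
    m ⊓ n * (q * lo * hi)        ≡⟨ *-assoc (m ⊓ n) (q * lo) hi ⟨
    m ⊓ n * (q * lo) * hi        ≤⟨ *-monoˡ-≤ hi (*-monoʳ-≤ (m ⊓ n) q*lo≤2*[m⊔n]) ⟩
    m ⊓ n * (2 * (m ⊔ n)) * hi   ≡⟨ cong (_* hi) (x∙yz≈y∙xz (m ⊓ n) 2 (m ⊔ n)) ⟩
    2 * (m ⊓ n * (m ⊔ n)) * hi   ≡⟨ cong (λ x → 2 * x * hi) (⊓*⊔≡* m n) ⟩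
    2 * (m * n) * hi             ∎
    where open ≤-Reasoning

  m+n≤2*[m⊔n] : ∀ m n → m + n ≤ 2 * (m ⊔ n)
  m+n≤2*[m⊔n] m n = begin
    m + n               ≤⟨ +-mono-≤ (m≤m⊔n m n) (m≤n⊔m m n) ⟩
    (m ⊔ n) + (m ⊔ n)   ≡⟨ cong ((m ⊔ n) +_) (*-identityˡ (m ⊔ n)) ⟨
    2 * (m ⊔ n)         ∎
    where open ≤-Reasoning

  prodℕ : List ℕ → (ℕ → ℕ) → ℕ
  prodℕ []      g = 1
  prodℕ (v ∷ S) g = g v * prodℕ S g

  prodℕ-nonZero : ∀ S {g} → (∀ v → NonZero (g v)) → NonZero (prodℕ S g)
  prodℕ-nonZero []      g≢0 = _
  prodℕ-nonZero (v ∷ S) g≢0 = m*n≢0 _ _ {{g≢0 v}} {{prodℕ-nonZero S g≢0}}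

  prodℕ-cong : ∀ S {f g} → All (λ v → f v ≡ g v) S → prodℕ S f ≡ prodℕ S g
  prodℕ-cong []      []            = refl
  prodℕ-cong (v ∷ S) (fv≡gv ∷ f≡g) = cong₂ _*_ fv≡gv (prodℕ-cong S f≡g)

  prodℕ-* : ∀ S f g → prodℕ S (λ v → f v * g v) ≡ prodℕ S f * prodℕ S g
  prodℕ-* []      f g = refl
  prodℕ-* (v ∷ S) f g =
    trans (cong (f v * g v *_) (prodℕ-* S f g)) (*-interchange (f v) (g v) (prodℕ S f) (prodℕ S g))

module PrimeParts where

  open import Defs using (ppow)
  open import Data.Nat.Base
  open import Data.Nat.Properties
  open import Data.Nat.Divisibility
  open import Data.Nat.DivMod using (_/_; m*[n/m]≡n; m/n<m)
  open import Data.Nat.Primality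
  open import Algebra.Properties.CommutativeSemigroup *-commutativeSemigroup
    using (x∙yz≈y∙xz) renaming (interchange to *-interchange)
  open import Data.List using (List; []; _∷_)
  open import Data.List.Relation.Unary.All as All using (All; []; _∷_)
  open import Data.List.Relation.Unary.AllPairs using (_∷_)
  open import Data.List.Relation.Unary.Unique.Propositional using (Unique)
  open import Data.Product using (∃-syntax; _×_; _,_)
  open import Data.Sum using (inj₁; inj₂)
  open import Function using (_∘_; it)
  open import Relation.Nullary using (yes; no; contradiction)
  open import Relation.Binary.PropositionalEquality
  open import Relation.Binary.Definitions using (tri<; tri≈; tri>)
  open Arithmetic

  private variable p n m i j k : ℕ

  record Multiplicity (p n k : ℕ) : Set where
    constructor _,_
    field
      pᵏ∣n   : p ^ k ∣ n
      pᵏ⁺¹∤n : p ^ suc k ∤ n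

  multiplicity-unique : Multiplicity p n i → Multiplicity p n j → i ≡ j
  multiplicity-unique {p} {i = i} {j} (pⁱ∣n , pⁱ⁺¹∤n) (pʲ∣n , pʲ⁺¹∤n) with <-cmp i j
  ... | tri< i<j _ _ = contradiction (∣-trans (^-monoʳ-∣ p i<j) pʲ∣n) pⁱ⁺¹∤n
  ... | tri≈ _ i≡j _ = i≡j
  ... | tri> _ _ j<i = contradiction (∣-trans (^-monoʳ-∣ p j<i) pⁱ∣n) pʲ⁺¹∤n

  multiplicity-zero : p ∤ n → Multiplicity p n 0
  multiplicity-zero {p} {n} p∤n = 1∣ n , p∤n ∘ subst (_∣ n) (*-identityʳ p)

  multiplicity-suc : .{{NonZero p}} → Multiplicity p n k → Multiplicity p (p * n) (suc k)
  multiplicity-suc {p} (pᵏ∣n , pᵏ⁺¹∤n) = *-monoʳ-∣ p pᵏ∣n , pᵏ⁺¹∤n ∘ *-cancelˡ-∣ p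

  ∤-cofactor : (mult : Multiplicity p n k) → p ∤ quotient (Multiplicity.pᵏ∣n mult)
  ∤-cofactor {p} {k = k} (pᵏ∣n , pᵏ⁺¹∤n) p∣c =
    pᵏ⁺¹∤n (subst (p ^ suc k ∣_) (sym (m∣n⇒n≡quotient*m pᵏ∣n)) (*-monoˡ-∣ (p ^ k) p∣c))

  multiplicity-* : Prime p → Multiplicity p m i → Multiplicity p n j → Multiplicity p (m * n) (i + j)
  multiplicity-* {p} {m} {i} {n} {j} pp multᵐ@(pⁱ∣m , _) multⁿ@(pʲ∣n , _) =
    pⁱ⁺ʲ∣mn , pⁱ⁺ʲ⁺¹∤mn
    where
    instance _ = m^n≢0 p (i + j) {{prime⇒nonZero pp}}
    c = quotient pⁱ∣m
    d = quotient pʲ∣n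
    mn≡cd*pⁱ⁺ʲ : m * n ≡ (c * d) * p ^ (i + j)
    mn≡cd*pⁱ⁺ʲ = begin
      m * n                       ≡⟨ cong₂ _*_ (m∣n⇒n≡quotient*m pⁱ∣m) (m∣n⇒n≡quotient*m pʲ∣n) ⟩
      (c * p ^ i) * (d * p ^ j)   ≡⟨ *-interchange c (p ^ i) d (p ^ j) ⟩
      (c * d) * (p ^ i * p ^ j)   ≡⟨ cong ((c * d) *_) (^-distribˡ-+-* p i j) ⟨
      (c * d) * p ^ (i + j)       ∎
      where open ≡-Reasoning
    pⁱ⁺ʲ∣mn : p ^ (i + j) ∣ m * n
    pⁱ⁺ʲ∣mn = subst (_∣ m * n) (sym (^-distribˡ-+-* p i j)) (*-pres-∣ pⁱ∣m pʲ∣n)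
    pⁱ⁺ʲ⁺¹∤mn : p ^ suc (i + j) ∤ m * n
    pⁱ⁺ʲ⁺¹∤mn h
      with euclidsLemma c d pp (*-cancelʳ-∣ (p ^ (i + j)) (subst (p ^ suc (i + j) ∣_) mn≡cd*pⁱ⁺ʲ h))
    ... | inj₁ p∣c = ∤-cofactor multᵐ p∣c
    ... | inj₂ p∣d = ∤-cofactor multⁿ p∣d

  ppow-multiplicity : ∀ r f {n} → .{{NonZero n}} → n ≤ f →
                      ∃[ k ] ppow (2 + r) n f ≡ (2 + r) ^ k × Multiplicity (2 + r) n k
  ppow-multiplicity r zero    {n} n≤0 = contradiction (≤-trans (>-nonZero⁻¹ n) n≤0) λ ()
  ppow-multiplicity r (suc f) {n} n≤1+f with 2 + r ∣? n
  ... | no  p∤n = 0 , refl , multiplicity-zero p∤n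
  ... | yes p∣n with ppow-multiplicity r f {n / (2 + r)} {{n/p≢0}} n/p≤f
    where
    n/p≢0 : NonZero (n / (2 + r))
    n/p≢0 = m*n≢0⇒n≢0 (2 + r) {{subst NonZero (sym (m*[n/m]≡n p∣n)) it}}
    n/p≤f : n / (2 + r) ≤ f
    n/p≤f = ≤-pred (≤-trans (m/n<m n (2 + r) (s≤s (s≤s z≤n))) n≤1+f)
  ... | k , ppow≡pᵏ , mult = suc k , cong ((2 + r) *_) ppow≡pᵏ ,
        subst (λ x → Multiplicity (2 + r) x (suc k)) (m*[n/m]≡n p∣n) (multiplicity-suc mult)

  part : ℕ → ℕ → ℕ
  part p n = ppow p n n

  ppow-nonZero : ∀ p n f → NonZero (ppow p n f)
  ppow-nonZero zero    n f       = _
  ppow-nonZero (suc p) n zero    = _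
  ppow-nonZero (suc p) n (suc f) with suc p ∣? n
  ... | yes _ = m*n≢0 (suc p) (ppow (suc p) (n / suc p) f) {{_}} {{ppow-nonZero (suc p) (n / suc p) f}}
  ... | no  _ = _

  part-nonZero : ∀ p n → NonZero (part p n)
  part-nonZero p n = ppow-nonZero p n n

  part-multiplicity : Prime p → .{{NonZero n}} → ∃[ k ] part p n ≡ p ^ k × Multiplicity p n k
  part-multiplicity {0}           {n} pp = contradiction pp ¬prime[0]
  part-multiplicity {1}           {n} pp = contradiction pp ¬prime[1]
  part-multiplicity {suc (suc r)} {n} pp = ppow-multiplicity r n ≤-refl

  part-* : Prime p → .{{NonZero m}} → .{{NonZero n}} → part p (m * n) ≡ part p m * part p n
  part-* {p} {m} {n} pp
    with part-multiplicity {n = m} pp | part-multiplicity {n = n} pp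
       | part-multiplicity {n = m * n} pp {{m*n≢0 m n}}
  ... | i , eᵐ , multᵐ | j , eⁿ , multⁿ | k , e , mult = begin
    part p (m * n)      ≡⟨ e ⟩
    p ^ k               ≡⟨ cong (p ^_) (multiplicity-unique mult (multiplicity-* pp multᵐ multⁿ)) ⟩
    p ^ (i + j)         ≡⟨ ^-distribˡ-+-* p i j ⟩
    p ^ i * p ^ j       ≡⟨ cong₂ _*_ eᵐ eⁿ ⟨
    part p m * part p n ∎
    where open ≡-Reasoning

  part-⊓-part : Prime p → .{{NonZero m}} → .{{NonZero n}} →
                ∃[ k ] part p m ⊓ part p n ≡ p ^ k × p ^ k ∣ m × p ^ k ∣ n
  part-⊓-part {p} {m} {n} pp with part-multiplicity {n = m} pp | part-multiplicity {n = n} pp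
  ... | i , eᵐ , multᵐ | j , eⁿ , multⁿ =
    i ⊓ j , part⊓part≡pⁱ⊓ʲ ,
    ∣-trans (^-monoʳ-∣ p (m⊓n≤m i j)) (Multiplicity.pᵏ∣n multᵐ) ,
    ∣-trans (^-monoʳ-∣ p (m⊓n≤n i j)) (Multiplicity.pᵏ∣n multⁿ)
    where
    instance _ = prime⇒nonZero pp
    part⊓part≡pⁱ⊓ʲ : part p m ⊓ part p n ≡ p ^ (i ⊓ j)
    part⊓part≡pⁱ⊓ʲ = begin
      part p m ⊓ part p n ≡⟨ cong₂ _⊓_ eᵐ eⁿ ⟩
      p ^ i ⊓ p ^ j       ≡⟨ mono-≤-distrib-⊓ {p ^_} (^-monoʳ-≤ p) i j ⟨
      p ^ (i ⊓ j)         ∎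
      where open ≡-Reasoning

  prime∤prime^ : ∀ {q} → Prime p → Prime q → p ≢ q → ∀ k → p ∤ q ^ k
  prime∤prime^ pp _ _ zero p∣1 = ¬prime[1] (subst Prime (∣1⇒≡1 p∣1) pp)
  prime∤prime^ {p} {q} pp pq p≢q (suc k) p∣qᵏ⁺¹ with euclidsLemma q (q ^ k) pp p∣qᵏ⁺¹
  ... | inj₂ p∣qᵏ = prime∤prime^ pp pq p≢q k p∣qᵏ
  ... | inj₁ p∣q with prime⇒irreducible pq p∣q
  ...   | inj₁ p≡1 = ¬prime[1] (subst Prime p≡1 pp)
  ...   | inj₂ p≡q = p≢q p≡q

  *-prime^-∣ : ∀ {v x} k → Prime v → v ∤ x → x ∣ n → v ^ k ∣ n → x * v ^ k ∣ n
  *-prime^-∣ {n} {x = x} zero _ _ x∣n _ = subst (_∣ n) (sym (*-identityʳ x)) x∣n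
  *-prime^-∣ {n} {v} {x} (suc k) pv v∤x x∣n vᵏ⁺¹∣n = divides c′ n≡c′*[x*vᵏ⁺¹]
    where
    instance _ = m^n≢0 v k {{prime⇒nonZero pv}}
    xvᵏ∣n : x * v ^ k ∣ n
    xvᵏ∣n = *-prime^-∣ k pv v∤x x∣n (m*n∣⇒n∣ v (v ^ k) vᵏ⁺¹∣n)
    c = quotient xvᵏ∣n
    n≡c*[x*vᵏ] : n ≡ c * (x * v ^ k)
    n≡c*[x*vᵏ] = m∣n⇒n≡quotient*m xvᵏ∣n
    v∣c : v ∣ c
    v∣c with euclidsLemma c x pv (*-cancelʳ-∣ (v ^ k)
                (subst (v ^ suc k ∣_) (trans n≡c*[x*vᵏ] (sym (*-assoc c x (v ^ k)))) vᵏ⁺¹∣n))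
    ... | inj₁ v∣c = v∣c
    ... | inj₂ v∣x = contradiction v∣x v∤x
    c′ = quotient v∣c
    n≡c′*[x*vᵏ⁺¹] : n ≡ c′ * (x * v ^ suc k)
    n≡c′*[x*vᵏ⁺¹] = begin
      n                      ≡⟨ n≡c*[x*vᵏ] ⟩
      c * (x * v ^ k)        ≡⟨ cong (_* (x * v ^ k)) (m∣n⇒n≡quotient*m v∣c) ⟩
      c′ * v * (x * v ^ k)   ≡⟨ *-assoc c′ v _ ⟩
      c′ * (v * (x * v ^ k)) ≡⟨ cong (c′ *_) (x∙yz≈y∙xz v x (v ^ k)) ⟩
      c′ * (x * v ^ suc k)   ∎
      where open ≡-Reasoning

  *-prodℕ-∣ : ∀ {x} S → All Prime S → Unique S → (g : ℕ → ℕ) →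
              All (λ v → ∃[ k ] g v ≡ v ^ k × v ^ k ∣ n) S →
              All (_∤ x) S → x ∣ n → x * prodℕ S g ∣ n
  *-prodℕ-∣ {n} {x} [] _ _ _ _ _ x∣n = subst (_∣ n) (sym (*-identityʳ x)) x∣n
  *-prodℕ-∣ {n} {x} (v ∷ S) (pv ∷ ps) (v∉S ∷ u) g ((k , gv≡vᵏ , vᵏ∣n) ∷ gs) (v∤x ∷ S∤x) x∣n =
    subst (_∣ n) (*-assoc x (g v) (prodℕ S g))
      (*-prodℕ-∣ S ps u g gs (All.zipWith ∤x*gv (v∉S , All.zip (ps , S∤x))) x*gv∣n)
    where
    x*gv∣n : x * g v ∣ n
    x*gv∣n = subst (λ z → x * z ∣ n) (sym gv≡vᵏ) (*-prime^-∣ k pv v∤x x∣n vᵏ∣n)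
    ∤x*gv : ∀ {p} → v ≢ p × Prime p × p ∤ x → p ∤ x * g v
    ∤x*gv {p} (v≢p , pp , p∤x) p∣x*gv with euclidsLemma x (g v) pp p∣x*gv
    ... | inj₁ p∣x  = p∤x p∣x
    ... | inj₂ p∣gv = prime∤prime^ pp pv (v≢p ∘ sym) k (subst (p ∣_) gv≡vᵏ p∣gv)

  gcdPart lcmPart : List ℕ → ℕ → ℕ → ℕ
  gcdPart S a b = prodℕ S (λ v → part v a ⊓ part v b)
  lcmPart S a b = prodℕ S (λ v → part v a ⊔ part v b)

  gcdPart-nonZero : ∀ S a b → NonZero (gcdPart S a b)
  gcdPart-nonZero S a b = prodℕ-nonZero S λ v → ⊓-nonZero _ _ {{part-nonZero v a}} {{part-nonZero v b}}

  lcmPart-nonZero : ∀ S a b → NonZero (lcmPart S a b)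
  lcmPart-nonZero S a b = prodℕ-nonZero S λ v → ⊔-nonZero _ _ {{part-nonZero v a}}

  gcdPart*lcmPart-nonZero : ∀ S a b → NonZero (gcdPart S a b * lcmPart S a b)
  gcdPart*lcmPart-nonZero S a b = m*n≢0 _ _ {{gcdPart-nonZero S a b}} {{lcmPart-nonZero S a b}}

  prodℕ-part-* : ∀ S → All Prime S → ∀ a b → .{{NonZero a}} → .{{NonZero b}} →
                 prodℕ S (λ v → part v (a * b)) ≡ gcdPart S a b * lcmPart S a b
  prodℕ-part-* S ps a b = begin
    prodℕ S (λ v → part v (a * b))
      ≡⟨ prodℕ-cong S (All.map part-*≡⊓*⊔ ps) ⟩
    prodℕ S (λ v → (part v a ⊓ part v b) * (part v a ⊔ part v b))
      ≡⟨ prodℕ-* S _ _ ⟩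
    gcdPart S a b * lcmPart S a b
      ∎
    where
    open ≡-Reasoning
    part-*≡⊓*⊔ : ∀ {v} → Prime v → part v (a * b) ≡ (part v a ⊓ part v b) * (part v a ⊔ part v b)
    part-*≡⊓*⊔ {v} pv = trans (part-* pv) (sym (⊓*⊔≡* (part v a) (part v b)))

  *-gcdPart-∣ : ∀ {q d} S → All Prime S → Unique S → All (_∤ q) S →
                ∀ a b → .{{NonZero a}} → .{{NonZero b}} →
                (∀ {k} → k ∣ a → k ∣ b → k ∣ d) → q ∣ d → q * gcdPart S a b ∣ d
  *-gcdPart-∣ {q} {d} S ps u S∤q a b common∣d q∣d =
    *-prodℕ-∣ S ps u (λ v → part v a ⊓ part v b) (All.map part⊓part-power-∣ ps) S∤q q∣d
    where
    part⊓part-power-∣ : ∀ {v} → Prime v → ∃[ k ] part v a ⊓ part v b ≡ v ^ k × v ^ k ∣ d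
    part⊓part-power-∣ pv with part-⊓-part {m = a} {n = b} pv
    ... | k , e , vᵏ∣a , vᵏ∣b = k , e , common∣d vᵏ∣a vᵏ∣b

module Fractions where

  open import Defs using (prodP)
  open import Data.Nat as ℕ using (suc)
  import Data.Nat.Properties as ℕP
  open import Data.Integer as ℤ using (+_; 1ℤ)
  import Data.Integer.Properties as ℤP
  open import Data.List using ([]; _∷_)
  open import Data.List.Relation.Unary.All using (All; []; _∷_)
  open import Data.Rational
  open import Data.Rational.Properties
  open import Data.Rational.Unnormalised as ℚᵘ using (mkℚᵘ; *≤*)
  import Data.Rational.Unnormalised.Properties as ℚᵘP
  open import Data.Sum using (inj₁; inj₂)
  open import Relation.Binary.PropositionalEquality
  open import Function using (it)
  open Arithmetic using (prodℕ; prodℕ-nonZero; ⊔-nonZero; ⊓*[q*[lo*hi]]≤2*[m*n]*hi)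

  fromℚᵘ-* : ∀ p q → fromℚᵘ (p ℚᵘ.* q) ≡ fromℚᵘ p * fromℚᵘ q
  fromℚᵘ-* p q = toℚᵘ-injective (begin
    toℚᵘ (fromℚᵘ (p ℚᵘ.* q))              ≈⟨ toℚᵘ-fromℚᵘ (p ℚᵘ.* q) ⟩
    p ℚᵘ.* q                               ≈⟨ ℚᵘP.*-cong (toℚᵘ-fromℚᵘ p) (toℚᵘ-fromℚᵘ q) ⟨
    toℚᵘ (fromℚᵘ p) ℚᵘ.* toℚᵘ (fromℚᵘ q)   ≈⟨ toℚᵘ-homo-* (fromℚᵘ p) (fromℚᵘ q) ⟨
    toℚᵘ (fromℚᵘ p * fromℚᵘ q)             ∎)
    where open ℚᵘP.≃-Reasoning

  fromℚᵘ-mono-≤ : ∀ p q → p ℚᵘ.≤ q → fromℚᵘ p ≤ fromℚᵘ q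
  fromℚᵘ-mono-≤ p q p≤q = toℚᵘ-cancel-≤
    (ℚᵘP.≤-respˡ-≃ (ℚᵘP.≃-sym (toℚᵘ-fromℚᵘ p)) (ℚᵘP.≤-respʳ-≃ (ℚᵘP.≃-sym (toℚᵘ-fromℚᵘ q)) p≤q))

  -- i / suc m is definitionally fromℚᵘ (mkℚᵘ i m), and ℚᵘ multiplies without normalising.
  /-* : ∀ i j m n .{{_ : ℕ.NonZero m}} .{{_ : ℕ.NonZero n}} →
        (i / m) * (j / n) ≡ ((i ℤ.* j) / (m ℕ.* n)) {{ℕP.m*n≢0 m n}}
  /-* i j (suc m) (suc n) = sym (fromℚᵘ-* (mkℚᵘ i m) (mkℚᵘ j n))

  /-mono-≤ : ∀ a m b n .{{_ : ℕ.NonZero m}} .{{_ : ℕ.NonZero n}} →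
             a ℕ.* n ℕ.≤ b ℕ.* m → (+ a) / m ≤ (+ b) / n
  /-mono-≤ a (suc m) b (suc n) a*n≤b*m =
    fromℚᵘ-mono-≤ (mkℚᵘ (+ a) m) (mkℚᵘ (+ b) n)
      (*≤* (subst₂ ℤ._≤_ (ℤP.pos-* a (suc n)) (ℤP.pos-* b (suc m)) (ℤ.+≤+ a*n≤b*m)))

  [a/1]*[1/d]≡a/d : ∀ a d .{{_ : ℕ.NonZero d}} → ((+ a) / 1) * (1ℤ / d) ≡ (+ a) / d
  [a/1]*[1/d]≡a/d a d =
    trans (/-* (+ a) 1ℤ 1 d) (/-cong {{ℕP.m*n≢0 1 d}} (ℤP.*-identityʳ (+ a)) (ℕP.*-identityˡ d))

  /1-⊓ : ∀ m n → ((+ m) / 1) ⊓ ((+ n) / 1) ≡ (+ (m ℕ.⊓ n)) / 1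
  /1-⊓ m n with ℕP.≤-total m n
  ... | inj₁ m≤n = trans (p≤q⇒p⊓q≡p (/-mono-≤ m 1 n 1 (ℕP.*-monoˡ-≤ 1 m≤n)))
                         (/-cong (cong +_ (sym (ℕP.m≤n⇒m⊓n≡m m≤n))) refl)
  ... | inj₂ n≤m = trans (p≥q⇒p⊓q≡q (/-mono-≤ n 1 m 1 (ℕP.*-monoˡ-≤ 1 n≤m)))
                         (/-cong (cong +_ (sym (ℕP.m≥n⇒m⊓n≡n n≤m))) refl)

  1/-⊓ : ∀ m n .{{_ : ℕ.NonZero m}} .{{_ : ℕ.NonZero n}} →
         (1ℤ / m) ⊓ (1ℤ / n) ≡ (1ℤ / (m ℕ.⊔ n)) {{⊔-nonZero m n}}
  1/-⊓ m n with ℕP.≤-total m n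
  ... | inj₁ m≤n = trans (p≥q⇒p⊓q≡q (/-mono-≤ 1 n 1 m (ℕP.*-monoʳ-≤ 1 m≤n)))
                         (/-cong {1ℤ} {{it}} {{⊔-nonZero m n}} refl (sym (ℕP.m≤n⇒m⊔n≡n m≤n)))
  ... | inj₂ n≤m = trans (p≤q⇒p⊓q≡p (/-mono-≤ 1 m 1 n (ℕP.*-monoʳ-≤ 1 n≤m)))
                         (/-cong {1ℤ} {{it}} {{⊔-nonZero m n}} refl (sym (ℕP.m≥n⇒m⊔n≡m n≤m)))

  prodP-cong : ∀ S {f g} → All (λ v → f v ≡ g v) S → prodP S f ≡ prodP S g
  prodP-cong []      []            = refl
  prodP-cong (v ∷ S) (fv≡gv ∷ f≡g) = cong₂ _*_ fv≡gv (prodP-cong S f≡g)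

  prodP-1/ : ∀ S g (g≢0 : ∀ v → ℕ.NonZero (g v)) →
             prodP S (λ v → (1ℤ / g v) {{g≢0 v}}) ≡ (1ℤ / prodℕ S g) {{prodℕ-nonZero S g≢0}}
  prodP-1/ []      g g≢0 = refl
  prodP-1/ (v ∷ S) g g≢0 =
    trans (cong ((1ℤ / g v) {{g≢0 v}} *_) (prodP-1/ S g g≢0))
          (/-* 1ℤ 1ℤ (g v) (prodℕ S g) {{g≢0 v}} {{prodℕ-nonZero S g≢0}})

  ⊓/hi≤2/q*[m*n/[lo*hi]] : ∀ m n q lo hi →
                           .{{_ : ℕ.NonZero q}} .{{_ : ℕ.NonZero lo}} .{{_ : ℕ.NonZero hi}} →
               q ℕ.* lo ℕ.≤ 2 ℕ.* (m ℕ.⊔ n) →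
               (+ (m ℕ.⊓ n)) / hi ≤ ((+ 2) / q) * ((+ (m ℕ.* n)) / (lo ℕ.* hi)) {{ℕP.m*n≢0 lo hi}}
  ⊓/hi≤2/q*[m*n/[lo*hi]] m n q lo hi q*lo≤2*[m⊔n] = begin
    (+ (m ℕ.⊓ n)) / hi
      ≤⟨ /-mono-≤ (m ℕ.⊓ n) hi (2 ℕ.* (m ℕ.* n)) (q ℕ.* (lo ℕ.* hi))
                  (⊓*[q*[lo*hi]]≤2*[m*n]*hi m n q lo hi q*lo≤2*[m⊔n]) ⟩
    (+ (2 ℕ.* (m ℕ.* n))) / (q ℕ.* (lo ℕ.* hi))
      ≡⟨ /-cong (ℤP.pos-* 2 (m ℕ.* n)) refl ⟩
    ((+ 2) ℤ.* (+ (m ℕ.* n))) / (q ℕ.* (lo ℕ.* hi))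
      ≡⟨ /-* (+ 2) (+ (m ℕ.* n)) q (lo ℕ.* hi) ⟨
    ((+ 2) / q) * ((+ (m ℕ.* n)) / (lo ℕ.* hi))
      ∎
    where
    open ≤-Reasoning
    instance
      _ = ℕP.m*n≢0 lo hi
      _ = ℕP.m*n≢0 q (lo ℕ.* hi)

open import Defs
open import Data.Nat as ℕ using (ℕ)
open import Data.Nat.Primality using (Prime)
open import Data.Nat.Divisibility as ℕD using ()
open import Data.Integer as ℤ using (ℤ; +_; _-_)
open import Data.Integer.Divisibility using (_∣_)
open import Data.Rational using (ℚ; _≤_; _*_; _/_)
open import Data.List using (List)
open import Data.List.Relation.Unary.All using (All)
open import Data.List.Relation.Unary.Unique.Propositional using (Unique)
open import Relation.Nullary using (¬_)
open import Relation.Binary.PropositionalEquality using (_≢_)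

import Data.Nat.Properties as ℕP
import Data.Integer.Properties as ℤP
import Data.Integer.Divisibility.Signed as ℤD
open import Data.Integer using (0ℤ; 1ℤ; +[1+_]; -[1+_])
open import Data.Rational using (0ℚ; _⊓_)
open import Data.Rational.Properties
  using (≤-reflexive; p≤q⇒p⊓q≡p; p≥q⇒p⊓q≡q; *-zeroˡ; *-zeroʳ; /-cong; module ≤-Reasoning)
import Data.List.Relation.Unary.All as All
open import Data.Sum using (_⊎_; inj₁; inj₂)
open import Relation.Binary.PropositionalEquality
  using (_≡_; refl; sym; trans; cong; cong₂; module ≡-Reasoning)
open Arithmetic
open PrimeParts
open Fractions

zero⊎nonZero : ∀ i → i ≡ 0ℤ ⊎ ℤ.NonZero i
zero⊎nonZero (+ ℕ.zero) = inj₁ refl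
zero⊎nonZero +[1+ n ]   = inj₂ _
zero⊎nonZero -[1+ n ]   = inj₂ _

∣∣i∣∣j∣⇒∣∣i-j∣ : ∀ {k} i j → k ℕD.∣ ℤ.∣ i ∣ → k ℕD.∣ ℤ.∣ j ∣ → k ℕD.∣ ℤ.∣ i - j ∣
∣∣i∣∣j∣⇒∣∣i-j∣ {k} i j k∣i k∣j =
  ℤD.∣⇒∣ᵤ {+ k} {i - j} (ℤD.∣m∣n⇒∣m-n {+ k} {i} {j} (ℤD.∣ᵤ⇒∣ k∣i) (ℤD.∣ᵤ⇒∣ k∣j))

∣i-j∣≤2*[∣i∣⊔∣j∣] : ∀ i j → ℤ.∣ i - j ∣ ℕ.≤ 2 ℕ.* (ℤ.∣ i ∣ ℕ.⊔ ℤ.∣ j ∣)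
∣i-j∣≤2*[∣i∣⊔∣j∣] i j = ℕP.≤-trans (ℤP.∣i-j∣≤∣i∣+∣j∣ i j) (m+n≤2*[m⊔n] ℤ.∣ i ∣ ℤ.∣ j ∣)

absInf-nonNeg : ∀ y → 0ℚ ≤ absInf y
absInf-nonNeg y = /-mono-≤ 0 1 ℤ.∣ y ∣ 1 ℕ.z≤n

absP-nonZero : ∀ v y .{{_ : ℤ.NonZero y}} → absP v y ≡ (1ℤ / part v ℤ.∣ y ∣) {{part-nonZero v _}}
-- absP has a junk branch for a v-part 0; abstracting the NonZero proof along with the v-part makes it absurd.
absP-nonZero v +[1+ n ] with ppow v (ℕ.suc n) (ℕ.suc n) | part-nonZero v (ℕ.suc n)
... | ℕ.suc _ | _ = refl
absP-nonZero v -[1+ n ] with ppow v (ℕ.suc n) (ℕ.suc n) | part-nonZero v (ℕ.suc n)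
... | ℕ.suc _ | _ = refl

prodAbs-nonZero : ∀ S y .{{_ : ℤ.NonZero y}} →
  prodAbs S y ≡ ((+ ℤ.∣ y ∣) / prodℕ S (λ v → part v ℤ.∣ y ∣)) {{prodℕ-nonZero S λ v → part-nonZero v _}}
prodAbs-nonZero S y = begin
  ((+ n) / 1) * prodP S (λ v → absP v y)
    ≡⟨ cong (((+ n) / 1) *_) (prodP-cong S (All.universal (λ v → absP-nonZero v y) S)) ⟩
  ((+ n) / 1) * prodP S (λ v → (1ℤ / part v n) {{part-nonZero v n}})
    ≡⟨ cong (((+ n) / 1) *_) (prodP-1/ S _ λ v → part-nonZero v n) ⟩
  ((+ n) / 1) * (1ℤ / prodℕ S (λ v → part v n))
    ≡⟨ [a/1]*[1/d]≡a/d n _ ⟩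
  (+ n) / prodℕ S (λ v → part v n) ∎
  where
  open ≡-Reasoning
  n = ℤ.∣ y ∣
  instance _ = prodℕ-nonZero S λ v → part-nonZero v n

prodMin-zeroˡ : ∀ S y → prodMin S 0ℤ y ≡ 0ℚ
prodMin-zeroˡ S y = trans (cong (_* prodP S (λ v → absP v 0ℤ ⊓ absP v y)) (p≤q⇒p⊓q≡p (absInf-nonNeg y)))
                          (*-zeroˡ (prodP S (λ v → absP v 0ℤ ⊓ absP v y)))

prodMin-zeroʳ : ∀ S y → prodMin S y 0ℤ ≡ 0ℚ
prodMin-zeroʳ S y = trans (cong (_* prodP S (λ v → absP v y ⊓ absP v 0ℤ)) (p≥q⇒p⊓q≡q (absInf-nonNeg y)))
                          (*-zeroˡ (prodP S (λ v → absP v y ⊓ absP v 0ℤ)))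

*-prodAbs-zero : ∀ S r → r * prodAbs S 0ℤ ≡ 0ℚ
*-prodAbs-zero S r = trans (cong (r *_) (*-zeroˡ (prodP S (λ v → absP v 0ℤ)))) (*-zeroʳ r)

prodMin≤*prodAbs-degenerate : ∀ S r y₁ y₂ → y₁ ≡ 0ℤ ⊎ y₂ ≡ 0ℤ →
                              prodMin S y₁ y₂ ≤ r * prodAbs S (y₁ ℤ.* y₂)
prodMin≤*prodAbs-degenerate S r _ y₂ (inj₁ refl) =
  ≤-reflexive (trans (prodMin-zeroˡ S y₂) (sym (*-prodAbs-zero S r)))
prodMin≤*prodAbs-degenerate S r y₁ _ (inj₂ refl) =
  ≤-reflexive (trans (prodMin-zeroʳ S y₁)
                     (sym (trans (cong (λ y → r * prodAbs S y) (ℤP.*-zeroʳ y₁)) (*-prodAbs-zero S r))))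

module NonDegenerate (S : List ℕ) (y₁ y₂ : ℤ) .{{_ : ℤ.NonZero y₁}} .{{_ : ℤ.NonZero y₂}} where

  a b : ℕ
  a = ℤ.∣ y₁ ∣
  b = ℤ.∣ y₂ ∣

  instance
    _ = gcdPart-nonZero S a b
    _ = lcmPart-nonZero S a b
    _ = gcdPart*lcmPart-nonZero S a b

  prodMin≡ : prodMin S y₁ y₂ ≡ (+ (a ℕ.⊓ b)) / lcmPart S a b
  prodMin≡ = begin
    (((+ a) / 1) ⊓ ((+ b) / 1)) * prodP S (λ v → absP v y₁ ⊓ absP v y₂)
      ≡⟨ cong₂ _*_ (/1-⊓ a b) (prodP-cong S (All.universal absP-⊓ S)) ⟩
    ((+ (a ℕ.⊓ b)) / 1) * prodP S (λ v → (1ℤ / (part v a ℕ.⊔ part v b)) {{part⊔part≢0 v}})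
      ≡⟨ cong (((+ (a ℕ.⊓ b)) / 1) *_) (prodP-1/ S _ part⊔part≢0) ⟩
    ((+ (a ℕ.⊓ b)) / 1) * (1ℤ / lcmPart S a b)
      ≡⟨ [a/1]*[1/d]≡a/d (a ℕ.⊓ b) _ ⟩
    (+ (a ℕ.⊓ b)) / lcmPart S a b ∎
    where
    open ≡-Reasoning
    part⊔part≢0 : ∀ v → ℕ.NonZero (part v a ℕ.⊔ part v b)
    part⊔part≢0 v = ⊔-nonZero _ _ {{part-nonZero v a}}
    absP-⊓ : ∀ v → absP v y₁ ⊓ absP v y₂ ≡ (1ℤ / (part v a ℕ.⊔ part v b)) {{part⊔part≢0 v}}
    absP-⊓ v = trans (cong₂ _⊓_ (absP-nonZero v y₁) (absP-nonZero v y₂))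
                     (1/-⊓ (part v a) (part v b) {{part-nonZero v a}} {{part-nonZero v b}})

  prodAbs-*≡ : All Prime S → prodAbs S (y₁ ℤ.* y₂) ≡ (+ (a ℕ.* b)) / (gcdPart S a b ℕ.* lcmPart S a b)
  prodAbs-*≡ ps = trans (prodAbs-nonZero S (y₁ ℤ.* y₂))
    (/-cong (cong +_ (ℤP.abs-* y₁ y₂))
            (trans (cong (λ n → prodℕ S (λ v → part v n)) (ℤP.abs-* y₁ y₂)) (prodℕ-part-* S ps a b)))
    where
    instance
      _ = ℤP.i*j≢0 y₁ y₂
      _ = prodℕ-nonZero S λ v → part-nonZero v ℤ.∣ y₁ ℤ.* y₂ ∣

  q*gcdPart≤2*[a⊔b] : All Prime S → Unique S → y₁ ≢ y₂ → ∀ {q} → q ℕD.∣ ℤ.∣ y₁ - y₂ ∣ →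
                      All (λ p → ¬ (p ℕD.∣ q)) S → q ℕ.* gcdPart S a b ℕ.≤ 2 ℕ.* (a ℕ.⊔ b)
  q*gcdPart≤2*[a⊔b] ps u y₁≢y₂ q∣y₁-y₂ S∤q = ℕP.≤-trans
    (ℕD.∣⇒≤ {{y₁-y₂≢0}} (*-gcdPart-∣ S ps u S∤q a b (∣∣i∣∣j∣⇒∣∣i-j∣ y₁ y₂) q∣y₁-y₂))
    (∣i-j∣≤2*[∣i∣⊔∣j∣] y₁ y₂)
    where
    y₁-y₂≢0 : ℕ.NonZero ℤ.∣ y₁ - y₂ ∣
    y₁-y₂≢0 = ℕ.≢-nonZero λ ∣y₁-y₂∣≡0 → y₁≢y₂ (ℤP.i-j≡0⇒i≡j y₁ y₂ (ℤP.∣i∣≡0⇒i≡0 ∣y₁-y₂∣≡0))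

  prodMin≤*prodAbs : All Prime S → Unique S → y₁ ≢ y₂ → ∀ q .{{_ : ℕ.NonZero q}} →
                     q ℕD.∣ ℤ.∣ y₁ - y₂ ∣ → All (λ p → ¬ (p ℕD.∣ q)) S →
                     prodMin S y₁ y₂ ≤ ((+ 2) / q) * prodAbs S (y₁ ℤ.* y₂)
  prodMin≤*prodAbs ps u y₁≢y₂ q q∣y₁-y₂ S∤q = begin
    prodMin S y₁ y₂
      ≡⟨ prodMin≡ ⟩
    (+ (a ℕ.⊓ b)) / lcmPart S a b
      ≤⟨ ⊓/hi≤2/q*[m*n/[lo*hi]] a b q (gcdPart S a b) (lcmPart S a b)
                                (q*gcdPart≤2*[a⊔b] ps u y₁≢y₂ q∣y₁-y₂ S∤q) ⟩
    ((+ 2) / q) * ((+ (a ℕ.* b)) / (gcdPart S a b ℕ.* lcmPart S a b))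
      ≡⟨ cong (((+ 2) / q) *_) (prodAbs-*≡ ps) ⟨
    ((+ 2) / q) * prodAbs S (y₁ ℤ.* y₂) ∎
    where open ≤-Reasoning

lemma2p4 : (S : List ℕ) → All Prime S → Unique S →
  (y₁ y₂ Q : ℤ) → y₁ ≢ y₂ → (nz : ℕ.NonZero ℤ.∣ Q ∣) → Q ∣ (y₁ - y₂) →
  All (λ p → ¬ (p ℕD.∣ ℤ.∣ Q ∣)) S →
  prodMin S y₁ y₂ ≤ (((+ 2) / ℤ.∣ Q ∣) {{nz}}) * prodAbs S (y₁ ℤ.* y₂)
lemma2p4 S ps u y₁ y₂ Q y₁≢y₂ nz Q∣y₁-y₂ S∤Q with zero⊎nonZero y₁ | zero⊎nonZero y₂
... | inj₁ y₁≡0 | _         = prodMin≤*prodAbs-degenerate S (((+ 2) / ℤ.∣ Q ∣) {{nz}}) y₁ y₂ (inj₁ y₁≡0)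
... | inj₂ _    | inj₁ y₂≡0 = prodMin≤*prodAbs-degenerate S (((+ 2) / ℤ.∣ Q ∣) {{nz}}) y₁ y₂ (inj₂ y₂≡0)
... | inj₂ y₁≢0 | inj₂ y₂≢0 =
  NonDegenerate.prodMin≤*prodAbs S y₁ y₂ {{y₁≢0}} {{y₂≢0}} ps u y₁≢y₂ ℤ.∣ Q ∣ {{nz}} Q∣y₁-y₂ S∤Q
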